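{- Let $M$ be an ada. If $M_{\#}$ is atomless, then $M$ is atomless.
   Context: A $C$-algebra is an algebra $\langle M,\vee,\wedge,\neg\rangle$ of type $(2,2,1)$ satisfying, for all $\alpha,\beta,\gamma$: $\neg\neg\alpha=\alpha$; $\neg(\alpha\wedge\beta)=\neg\alpha\vee\neg\beta$; $(\alpha\wedge\beta)\wedge\gamma=\alpha\wedge(\beta\wedge\gamma)$; $\alpha\wedge(\beta\vee\gamma)=(\alpha\wedge\beta)\vee(\alpha\wedge\gamma)$; $(\alpha\vee\beta)\wedge\gamma=(\alpha\wedge\gamma)\vee(\neg\alpha\wedge\beta\wedge\gamma)$; $\alpha\vee(\alpha\wedge\beta)=\alpha$; $(\alpha\wedge\beta)\vee(\beta\wedge\alpha)=(\beta\wedge\alpha)\vee(\alpha\wedge\beta)$. A $C$-algebra with $T,F,U$ has nullary operations $T,F,U$: $T$ is the two-sided identity for $\wedge$, $F$ the two-sided identity for $\vee$, $U$ the fixed point of $\neg$. An ada is a $C$-algebra with $T,F,U$ together with a unary operation $(\cdot)^{\downarrow}$ satisfying $F^{\downarrow}=F$, $U^{\downarrow}=F$, $T^{\downarrow}=T$, $\alpha\wedge\beta^{\downarrow}=\alpha\wedge(\alpha\wedge\beta)^{\downarrow}$, $\alpha^{\downarrow}\vee\neg(\alpha^{\downarrow})=T$, $\alpha=\alpha^{\downarrow}\vee\alpha$. $M_{\#}=\{\alpha\in M:\alpha\vee\neg\alpha=T\}$. Order: $a\leq b$ iff $a\vee b=b$. For $A\subseteq M$ containing $F$, the atoms relative to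 $A$ are those $a\in A$, $a\neq F$, such that every $b\in A$ with $F\leq b\leq a$, $b\neq a$ equals $F$. $A$ is atomless if it has no atoms relative to $A$. -}

module Defs where

open import Level using (Level; suc; _⊔_; Lift)
open import Relation.Binary.PropositionalEquality using (_≡_)
open import Relation.Nullary using (¬_)
open import Data.Product using (Σ; _×_; ∃)
open import Relation.Unary using (Pred; _∈_)
open import Data.Unit using (⊤)

-- A C-algebra with T, F, U (identities / fixed point) and the ada operation ↓,
-- with equality taken to be propositional equality on the carrier.
record Ada (ℓ : Level) : Set (suc ℓ) where
  infixr 6 _∨_
  infixr 7 _∧_
  field
    Carrier : Set ℓ
    _∨_ _∧_ : Carrier → Carrier → Carrier
    ¬′_ : Carrier → Carrier
    T F Uu : Carrier
    _↓ : Carrier → Carrier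
    ¬¬ : ∀ α → ¬′ (¬′ α) ≡ α
    deMorgan : ∀ α β → ¬′ (α ∧ β) ≡ (¬′ α) ∨ (¬′ β)
    ∧-assoc : ∀ α β γ → (α ∧ β) ∧ γ ≡ α ∧ (β ∧ γ)
    ∧-distribˡ-∨ : ∀ α β γ → α ∧ (β ∨ γ) ≡ (α ∧ β) ∨ (α ∧ γ)
    ∨-∧-distribʳ : ∀ α β γ → (α ∨ β) ∧ γ ≡ (α ∧ γ) ∨ ((¬′ α) ∧ β ∧ γ)
    absorp : ∀ α β → α ∨ (α ∧ β) ≡ α
    ∧-∨-comm : ∀ α β → (α ∧ β) ∨ (β ∧ α) ≡ (β ∧ α) ∨ (α ∧ β)
    ∧-identityˡ : ∀ α → T ∧ α ≡ α
    ∧-identityʳ : ∀ α → α ∧ T ≡ α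
    ∨-identityˡ : ∀ α → F ∨ α ≡ α
    ∨-identityʳ : ∀ α → α ∨ F ≡ α
    ¬U : ¬′ Uu ≡ Uu
    F↓ : F ↓ ≡ F
    U↓ : Uu ↓ ≡ F
    T↓ : T ↓ ≡ T
    ↓-∧ : ∀ α β → α ∧ (β ↓) ≡ α ∧ ((α ∧ β) ↓)
    ↓-classical : ∀ α → (α ↓) ∨ (¬′ (α ↓)) ≡ T
    ↓-∨ : ∀ α → α ≡ (α ↓) ∨ α

  _≤_ : Carrier → Carrier → Set ℓ
  a ≤ b = a ∨ b ≡ b

  M# : Pred Carrier ℓ
  M# α = α ∨ (¬′ α) ≡ T

  -- atoms relative to a subset A (A is assumed to contain F in the paper)
  IsAtomOf : Pred Carrier ℓ → Carrier → Set ℓ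
  IsAtomOf A a =
    a ∈ A × ¬ (a ≡ F) ×
    (∀ b → b ∈ A → F ≤ b → b ≤ a → ¬ (b ≡ a) → b ≡ F)

  Atomless : Pred Carrier ℓ → Set ℓ
  Atomless A = ¬ (∃ λ a → IsAtomOf A a)

  Whole : Pred Carrier ℓ
  Whole _ = Lift ℓ ⊤

module Submission where

-- Suppose a is an atom of M.  Its "classical shadow" c = ¬((¬a)↓) lies in M_#
-- (the ada axiom α↓ ∨ ¬(α↓) = T) and is nonzero (c = F would force ¬a = T).
-- We show c is an atom of M_#.  Let b ∈ M_# with b ≤ c.  Since b is classical,
-- b ∧ a ≤ a, so by atomicity of a either b ∧ a = F or b ∧ a = a.  The key fact
-- is that a classical element disjoint from a lies below (¬a)↓, hence is
-- disjoint from c.  In the first case b = b ∧ c = F; in the second ¬b is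
-- disjoint from a, hence from c, and splitting c along b gives c = b.

open import Defs
open import Level using (Level; lift)
open import Relation.Binary.PropositionalEquality
open import Data.Product using (_,_)
open import Relation.Nullary using (¬_)

module AdaLemmas {ℓ : Level} (M : Ada ℓ) where
  open Ada M
  open ≡-Reasoning

  ¬-injective : ∀ {x y} → ¬′ x ≡ ¬′ y → x ≡ y
  ¬-injective {x} {y} p = trans (sym (¬¬ x)) (trans (cong ¬′_ p) (¬¬ y))

  ¬T≡F : ¬′ T ≡ F
  ¬T≡F = begin
    ¬′ T                 ≡⟨ sym (∨-identityʳ _) ⟩
    ¬′ T ∨ F             ≡⟨ cong (¬′ T ∨_) (sym (¬¬ F)) ⟩
    ¬′ T ∨ ¬′ (¬′ F)     ≡⟨ sym (deMorgan T (¬′ F)) ⟩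
    ¬′ (T ∧ ¬′ F)        ≡⟨ cong ¬′_ (∧-identityˡ _) ⟩
    ¬′ (¬′ F)            ≡⟨ ¬¬ F ⟩
    F                    ∎

  ¬F≡T : ¬′ F ≡ T
  ¬F≡T = trans (cong ¬′_ (sym ¬T≡F)) (¬¬ T)

  deMorgan-∨ : ∀ x y → ¬′ (x ∨ y) ≡ ¬′ x ∧ ¬′ y
  deMorgan-∨ x y = begin
    ¬′ (x ∨ y)                  ≡⟨ cong₂ (λ u v → ¬′ (u ∨ v)) (sym (¬¬ x)) (sym (¬¬ y)) ⟩
    ¬′ (¬′ (¬′ x) ∨ ¬′ (¬′ y))  ≡⟨ cong ¬′_ (sym (deMorgan _ _)) ⟩
    ¬′ (¬′ (¬′ x ∧ ¬′ y))       ≡⟨ ¬¬ _ ⟩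
    ¬′ x ∧ ¬′ y                 ∎

  ∧-absorbs-∨ : ∀ x y → x ∧ (x ∨ y) ≡ x
  ∧-absorbs-∨ x y = ¬-injective (begin
    ¬′ (x ∧ (x ∨ y))        ≡⟨ deMorgan _ _ ⟩
    ¬′ x ∨ ¬′ (x ∨ y)       ≡⟨ cong (¬′ x ∨_) (deMorgan-∨ x y) ⟩
    ¬′ x ∨ (¬′ x ∧ ¬′ y)    ≡⟨ absorp _ _ ⟩
    ¬′ x                    ∎)

  T∨x≡T : ∀ x → T ∨ x ≡ T
  T∨x≡T x = trans (cong (T ∨_) (sym (∧-identityˡ x))) (absorp T x)

  F∧x≡F : ∀ x → F ∧ x ≡ F
  F∧x≡F x = trans (cong (F ∧_) (sym (∨-identityˡ x))) (∧-absorbs-∨ F x)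

  ∨-idem : ∀ x → x ∨ x ≡ x
  ∨-idem x = trans (cong (x ∨_) (sym (∧-identityʳ x))) (absorp x T)

  ∧-idem : ∀ x → x ∧ x ≡ x
  ∧-idem x = trans (cong (x ∧_) (sym (∨-identityʳ x))) (∧-absorbs-∨ x F)

  ∨-assoc : ∀ x y z → (x ∨ y) ∨ z ≡ x ∨ (y ∨ z)
  ∨-assoc x y z = ¬-injective (begin
    ¬′ ((x ∨ y) ∨ z)        ≡⟨ deMorgan-∨ _ _ ⟩
    ¬′ (x ∨ y) ∧ ¬′ z       ≡⟨ cong (_∧ ¬′ z) (deMorgan-∨ x y) ⟩
    (¬′ x ∧ ¬′ y) ∧ ¬′ z    ≡⟨ ∧-assoc _ _ _ ⟩
    ¬′ x ∧ (¬′ y ∧ ¬′ z)    ≡⟨ cong (¬′ x ∧_) (sym (deMorgan-∨ y z)) ⟩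
    ¬′ x ∧ ¬′ (y ∨ z)       ≡⟨ sym (deMorgan-∨ _ _) ⟩
    ¬′ (x ∨ (y ∨ z))        ∎)

  ∨≡F⇒ˡ≡F : ∀ x y → x ∨ y ≡ F → x ≡ F
  ∨≡F⇒ˡ≡F x y p = ¬-injective (trans ¬x≡T (sym ¬F≡T))
    where
    ¬x∧¬y≡T : ¬′ x ∧ ¬′ y ≡ T
    ¬x∧¬y≡T = trans (sym (deMorgan-∨ x y)) (trans (cong ¬′_ p) ¬F≡T)
    ¬x≡T : ¬′ x ≡ T
    ¬x≡T = begin
      ¬′ x                     ≡⟨ sym (∧-identityʳ _) ⟩
      ¬′ x ∧ T                 ≡⟨ cong (¬′ x ∧_) (sym ¬x∧¬y≡T) ⟩
      ¬′ x ∧ (¬′ x ∧ ¬′ y)     ≡⟨ sym (∧-assoc _ _ _) ⟩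
      (¬′ x ∧ ¬′ x) ∧ ¬′ y     ≡⟨ cong (_∧ ¬′ y) (∧-idem _) ⟩
      ¬′ x ∧ ¬′ y              ≡⟨ ¬x∧¬y≡T ⟩
      T                        ∎

  ≤⇒∧≡ : ∀ x y → x ≤ y → x ∧ y ≡ x
  ≤⇒∧≡ x y x≤y = trans (cong (x ∧_) (sym x≤y)) (∧-absorbs-∨ x y)

  M#-split : ∀ {b} → M# b → ∀ x → x ≡ (b ∧ x) ∨ (¬′ b ∧ x)
  M#-split {b} b# x = begin
    x                                ≡⟨ sym (∧-identityˡ x) ⟩
    T ∧ x                            ≡⟨ cong (_∧ x) (sym b#) ⟩
    (b ∨ ¬′ b) ∧ x                   ≡⟨ ∨-∧-distribʳ _ _ _ ⟩
    (b ∧ x) ∨ (¬′ b ∧ (¬′ b ∧ x))    ≡⟨ cong ((b ∧ x) ∨_) (sym (∧-assoc _ _ _)) ⟩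
    (b ∧ x) ∨ ((¬′ b ∧ ¬′ b) ∧ x)    ≡⟨ cong (λ u → (b ∧ x) ∨ (u ∧ x)) (∧-idem _) ⟩
    (b ∧ x) ∨ (¬′ b ∧ x)             ∎

  M#-∧F : ∀ {b} → M# b → b ∧ F ≡ F
  M#-∧F {b} b# = ∨≡F⇒ˡ≡F _ _ (sym (M#-split b# F))

  M#-¬∨ : ∀ {b} → M# b → ¬′ b ∨ b ≡ T
  M#-¬∨ {b} b# = begin
    ¬′ b ∨ b                             ≡⟨ cong₂ _∨_ (sym (∧-identityʳ _)) (sym b∧T∧T≡b) ⟩
    (¬′ b ∧ T) ∨ (¬′ (¬′ b) ∧ (T ∧ T))   ≡⟨ sym (∨-∧-distribʳ _ _ _) ⟩
    (¬′ b ∨ T) ∧ T                       ≡⟨ ∧-identityʳ _ ⟩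
    ¬′ b ∨ T                             ≡⟨ cong (¬′ b ∨_) (sym ¬F≡T) ⟩
    ¬′ b ∨ ¬′ F                          ≡⟨ sym (deMorgan _ _) ⟩
    ¬′ (b ∧ F)                           ≡⟨ cong ¬′_ (M#-∧F b#) ⟩
    ¬′ F                                 ≡⟨ ¬F≡T ⟩
    T                                    ∎
    where
    b∧T∧T≡b : ¬′ (¬′ b) ∧ (T ∧ T) ≡ b
    b∧T∧T≡b = trans (cong₂ _∧_ (¬¬ b) (∧-identityʳ T)) (∧-identityʳ b)

  M#-¬ : ∀ {b} → M# b → M# (¬′ b)
  M#-¬ {b} b# = trans (cong (¬′ b ∨_) (¬¬ b)) (M#-¬∨ b#)

  M#-∧¬ : ∀ {b} → M# b → b ∧ ¬′ b ≡ F
  M#-∧¬ {b} b# = ¬-injective (begin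
    ¬′ (b ∧ ¬′ b)       ≡⟨ deMorgan _ _ ⟩
    ¬′ b ∨ ¬′ (¬′ b)    ≡⟨ M#-¬ b# ⟩
    T                   ≡⟨ sym ¬F≡T ⟩
    ¬′ F                ∎)

  M#-¬∧ : ∀ {b} → M# b → ¬′ b ∧ b ≡ F
  M#-¬∧ {b} b# = ¬-injective (begin
    ¬′ (¬′ b ∧ b)       ≡⟨ deMorgan _ _ ⟩
    ¬′ (¬′ b) ∨ ¬′ b    ≡⟨ cong (_∨ ¬′ b) (¬¬ b) ⟩
    b ∨ ¬′ b            ≡⟨ b# ⟩
    T                   ≡⟨ sym ¬F≡T ⟩
    ¬′ F                ∎)

  M#-∧-≤ : ∀ {b} → M# b → ∀ x → (b ∧ x) ≤ x
  M#-∧-≤ {b} b# x = begin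
    (b ∧ x) ∨ x                             ≡⟨ cong ((b ∧ x) ∨_) (M#-split b# x) ⟩
    (b ∧ x) ∨ ((b ∧ x) ∨ (¬′ b ∧ x))        ≡⟨ sym (∨-assoc _ _ _) ⟩
    ((b ∧ x) ∨ (b ∧ x)) ∨ (¬′ b ∧ x)        ≡⟨ cong (_∨ (¬′ b ∧ x)) (∨-idem _) ⟩
    (b ∧ x) ∨ (¬′ b ∧ x)                    ≡⟨ sym (M#-split b# x) ⟩
    x                                       ∎

  M#-disjoint⇒∧¬ : ∀ {b} → M# b → ∀ x → b ∧ x ≡ F → b ∧ ¬′ x ≡ b
  M#-disjoint⇒∧¬ {b} b# x b∧x≡F = begin
    b ∧ ¬′ x                        ≡⟨ sym (∨-identityˡ _) ⟩
    F ∨ (b ∧ ¬′ x)                  ≡⟨ cong (_∨ (b ∧ ¬′ x)) (sym (M#-∧¬ b#)) ⟩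
    (b ∧ ¬′ b) ∨ (b ∧ ¬′ x)         ≡⟨ sym (∧-distribˡ-∨ _ _ _) ⟩
    b ∧ (¬′ b ∨ ¬′ x)               ≡⟨ cong (b ∧_) (sym (deMorgan b x)) ⟩
    b ∧ ¬′ (b ∧ x)                  ≡⟨ cong (λ u → b ∧ ¬′ u) b∧x≡F ⟩
    b ∧ ¬′ F                        ≡⟨ cong (b ∧_) ¬F≡T ⟩
    b ∧ T                           ≡⟨ ∧-identityʳ b ⟩
    b                               ∎

  ∧-↓-self : ∀ x → x ∧ x ↓ ≡ x
  ∧-↓-self x = begin
    x ∧ x ↓          ≡⟨ cong (λ u → x ∧ u ↓) (sym (∧-identityʳ x)) ⟩
    x ∧ (x ∧ T) ↓    ≡⟨ sym (↓-∧ x T) ⟩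
    x ∧ T ↓          ≡⟨ cong (x ∧_) T↓ ⟩
    x ∧ T            ≡⟨ ∧-identityʳ x ⟩
    x                ∎

  M#-disjoint⇒∧↓¬ : ∀ {b} → M# b → ∀ x → b ∧ x ≡ F → b ∧ (¬′ x) ↓ ≡ b
  M#-disjoint⇒∧↓¬ {b} b# x b∧x≡F = begin
    b ∧ (¬′ x) ↓         ≡⟨ ↓-∧ b (¬′ x) ⟩
    b ∧ (b ∧ ¬′ x) ↓     ≡⟨ cong (λ u → b ∧ u ↓) (M#-disjoint⇒∧¬ b# x b∧x≡F) ⟩
    b ∧ b ↓              ≡⟨ ∧-↓-self b ⟩
    b                    ∎

  shadow : Carrier → Carrier
  shadow x = ¬′ ((¬′ x) ↓)

  shadow-M# : ∀ x → M# (shadow x)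
  shadow-M# x = M#-¬ (↓-classical (¬′ x))

  shadow≡F⇒≡F : ∀ x → shadow x ≡ F → x ≡ F
  shadow≡F⇒≡F x p = ¬-injective (trans ¬x≡T (sym ¬F≡T))
    where
    ¬x↓≡T : (¬′ x) ↓ ≡ T
    ¬x↓≡T = ¬-injective (trans p (sym ¬T≡F))
    ¬x≡T : ¬′ x ≡ T
    ¬x≡T = begin
      ¬′ x                ≡⟨ ↓-∨ (¬′ x) ⟩
      (¬′ x) ↓ ∨ ¬′ x     ≡⟨ cong (_∨ ¬′ x) ¬x↓≡T ⟩
      T ∨ ¬′ x            ≡⟨ T∨x≡T _ ⟩
      T                   ∎

  M#-disjoint⇒disjoint-shadow : ∀ {b} → M# b → ∀ x → b ∧ x ≡ F → b ∧ shadow x ≡ F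
  M#-disjoint⇒disjoint-shadow {b} b# x b∧x≡F = begin
    b ∧ ¬′ d             ≡⟨ cong (_∧ ¬′ d) (sym (M#-disjoint⇒∧↓¬ b# x b∧x≡F)) ⟩
    (b ∧ d) ∧ ¬′ d       ≡⟨ ∧-assoc _ _ _ ⟩
    b ∧ (d ∧ ¬′ d)       ≡⟨ cong (b ∧_) (M#-∧¬ (↓-classical (¬′ x))) ⟩
    b ∧ F                ≡⟨ M#-∧F b# ⟩
    F                    ∎
    where
    d : Carrier
    d = (¬′ x) ↓

  below-shadow-disjoint : ∀ {b} x → M# b → b ≤ shadow x → b ∧ x ≡ F → b ≡ F
  below-shadow-disjoint {b} x b# b≤c b∧x≡F = begin
    b              ≡⟨ sym (≤⇒∧≡ b (shadow x) b≤c) ⟩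
    b ∧ shadow x   ≡⟨ M#-disjoint⇒disjoint-shadow b# x b∧x≡F ⟩
    F              ∎

  below-shadow-covering : ∀ {b} x → M# b → b ≤ shadow x → b ∧ x ≡ x → b ≡ shadow x
  below-shadow-covering {b} x b# b≤c b∧x≡x = sym (begin
    shadow x                              ≡⟨ M#-split b# (shadow x) ⟩
    (b ∧ shadow x) ∨ (¬′ b ∧ shadow x)    ≡⟨ cong₂ _∨_ (≤⇒∧≡ b (shadow x) b≤c) ¬b∧c≡F ⟩
    b ∨ F                                 ≡⟨ ∨-identityʳ b ⟩
    b                                     ∎)
    where
    ¬b∧x≡F : ¬′ b ∧ x ≡ F
    ¬b∧x≡F = begin
      ¬′ b ∧ x           ≡⟨ cong (¬′ b ∧_) (sym b∧x≡x) ⟩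
      ¬′ b ∧ (b ∧ x)     ≡⟨ sym (∧-assoc _ _ _) ⟩
      (¬′ b ∧ b) ∧ x     ≡⟨ cong (_∧ x) (M#-¬∧ b#) ⟩
      F ∧ x              ≡⟨ F∧x≡F x ⟩
      F                  ∎
    ¬b∧c≡F : ¬′ b ∧ shadow x ≡ F
    ¬b∧c≡F = M#-disjoint⇒disjoint-shadow (M#-¬ b#) x ¬b∧x≡F

  shadow-of-atom : ∀ a → IsAtomOf Whole a → IsAtomOf M# (shadow a)
  shadow-of-atom a (_ , a≢F , a-minimal) =
    shadow-M# a , (λ c≡F → a≢F (shadow≡F⇒≡F a c≡F)) , below
    where
    below : ∀ b → M# b → F ≤ b → b ≤ shadow a → ¬ (b ≡ shadow a) → b ≡ F
    below b b# _ b≤c b≢c = below-shadow-disjoint a b# b≤c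
      (a-minimal (b ∧ a) (lift _) (∨-identityˡ _) (M#-∧-≤ b# a)
        (λ b∧a≡a → b≢c (below-shadow-covering a b# b≤c b∧a≡a)))

theorem2p46 : {ℓ : Level} (M : Ada ℓ) → Ada.Atomless M (Ada.M# M) → Ada.Atomless M (Ada.Whole M)
theorem2p46 M M#-atomless (a , a-atom) = M#-atomless (shadow a , shadow-of-atom a a-atom)
  where open AdaLemmas M
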